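{- Let $G=K^c_{n,n}$ be an edge-colored complete balanced bipartite graph with bipartition $(X,Y)$ and $\delta^c(G)\geq \frac{2}{3}n+2$. Then for any four distinct vertices $x_1,x_2\in X$, $y_1,y_2\in Y$, there exist at least $\frac{4}{3}n$ edges $xy$ of $G$ with $x\in X\setminus\{x_1,x_2\}$ and $y\in Y\setminus\{y_1,y_2\}$ such that $x_1y_1xyx_2y_2$ is a properly colored path.
   Context: $K^c_{n,n}$ is $K_{n,n}$ with an arbitrary color assigned to each edge. A path is properly colored if every two adjacent edges have distinct colors. The color degree of a vertex is the number of distinct colors on its incident edges and $\delta^c$ is its minimum over all vertices. -}

module Defs where

open import Data.Nat using (ℕ; _≟_)
open import Data.Fin using (Fin)
open import Data.List using (List; length; map; allFin; filter; cartesianProduct)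
open import Data.List using (deduplicate)
open import Data.Product using (_×_; _,_; proj₁; proj₂)
open import Relation.Nullary using (¬_; Dec)
open import Relation.Nullary.Decidable using (_×-dec_; ¬?)
open import Relation.Binary.PropositionalEquality using (_≡_)

-- An edge-colouring of K_{n,n} with parts X = Fin n and Y = Fin n:
-- c x y is the colour of the edge xy (colours are natural numbers).
Colouring : ℕ → Set
Colouring n = Fin n → Fin n → ℕ

colDegX : ∀ {n} → Colouring n → Fin n → ℕ
colDegX {n} c x = length (deduplicate _≟_ (map (c x) (allFin n)))

colDegY : ∀ {n} → Colouring n → Fin n → ℕ
colDegY {n} c y = length (deduplicate _≟_ (map (λ x → c x y) (allFin n)))


-- x1 y1 x y x2 y2 is a properly coloured path (distinctness of the six
-- vertices is imposed separately).
ProperPath6 : ∀ {n} → Colouring n → (x₁ y₁ x y x₂ y₂ : Fin n) → Set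
ProperPath6 c x₁ y₁ x y x₂ y₂ =
  ¬ (c x₁ y₁ ≡ c x y₁) × ¬ (c x y₁ ≡ c x y) × ¬ (c x y ≡ c x₂ y) × ¬ (c x₂ y ≡ c x₂ y₂)

Good : ∀ {n} → Colouring n → (x₁ x₂ y₁ y₂ : Fin n) → Fin n × Fin n → Set
Good c x₁ x₂ y₁ y₂ (x , y) =
  (¬ x ≡ x₁ × ¬ x ≡ x₂ × ¬ y ≡ y₁ × ¬ y ≡ y₂) × ProperPath6 c x₁ y₁ x y x₂ y₂

good? : ∀ {n} (c : Colouring n) (x₁ x₂ y₁ y₂ : Fin n) (e : Fin n × Fin n) → Dec (Good c x₁ x₂ y₁ y₂ e)
good? c x₁ x₂ y₁ y₂ (x , y) =
  (¬? (x F≟ x₁) ×-dec ¬? (x F≟ x₂) ×-dec ¬? (y F≟ y₁) ×-dec ¬? (y F≟ y₂))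
  ×-dec (¬? (c x₁ y₁ ≟ c x y₁) ×-dec ¬? (c x y₁ ≟ c x y) ×-dec ¬? (c x y ≟ c x₂ y) ×-dec ¬? (c x₂ y ≟ c x₂ y₂))
  where open import Data.Fin using () renaming (_≟_ to _F≟_)

countGood : ∀ {n} → Colouring n → (x₁ x₂ y₁ y₂ : Fin n) → ℕ
countGood {n} c x₁ x₂ y₁ y₂ =
  length (filter (good? c x₁ x₂ y₁ y₂) (cartesianProduct (allFin n) (allFin n)))

{-# OPTIONS --safe #-}
module Submission where

open import Defs
open import Data.Nat using (ℕ; zero; suc; _+_; _*_; _≤_; z≤n; s≤s; _≟_)
open import Data.Nat.Properties
open import Data.Nat.Tactic.RingSolver using (solve-∀)
open import Data.Fin using (Fin; zero; suc) renaming (_≟_ to _F≟_)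
open import Data.List using ([]; _∷_; length; map; filter; tabulate; allFin; cartesianProduct; deduplicate; _++_)
open import Data.List.Properties using (filter-++; length-++; map-tabulate; length-tabulate)
open import Data.List.Relation.Unary.All using (All; []; _∷_)
open import Data.List.Relation.Unary.All.Properties using (all-filter)
open import Data.List.Relation.Unary.Unique.Propositional using (Unique; []; _∷_)
open import Data.List.Relation.Unary.Unique.Propositional.Properties using (allFin⁺)
  renaming (filter⁺ to unique-filter⁺)
import Data.List.Relation.Unary.Unique.DecPropositional.Properties as DecUnique
open import Data.List.Relation.Binary.Sublist.Propositional using (_⊆_; []; _∷_; ⊆-trans)
open import Data.List.Relation.Binary.Sublist.Propositional.Properties using (filter-⊆; length-mono-≤)
  renaming (filter⁺ to sublist-filter⁺)
open import Data.Product using (_×_; _,_)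
open import Data.Bool using (if_then_else_)
open import Function using (_∘_; id)
open import Relation.Nullary using (¬_; Dec; yes; no; does; contradiction)
open import Relation.Nullary.Decidable using (¬?; _×-dec_)
open import Relation.Unary using (Pred; Decidable)
open import Relation.Binary.Definitions using (DecidableEquality)
open import Relation.Binary.PropositionalEquality
  using (_≡_; refl; sym; trans; cong; cong₂; subst; module ≡-Reasoning)
open import Algebra.Properties.Semiring.Sum +-*-semiring
  using (sum-syntax; ∑-distrib-+; ∑-comm; *-distribˡ-sum; *-distribʳ-sum; sum-cong-≗)

-- Let A be the set of x ∉ {x₁, x₂} with c(xy₁) ≠ c(x₁y₁) and B the set of y ∉ {y₁, y₂} with
-- c(x₂y) ≠ c(x₂y₂). A colour class at a vertex has at most n + 1 − δᶜ ≤ n/3 − 1 edges, so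
-- |A|, |B| ≥ 2n/3. For x ∈ A and y ∈ B the path x₁y₁xyx₂y₂ is properly coloured unless
-- c(xy) = c(xy₁) or c(xy) = c(x₂y); each x ∈ A has at most n/3 − 1 partners y of the first kind and
-- each y ∈ B at most n/3 − 1 partners x of the second, leaving |A||B| − (n/3 − 1)(|A| + |B|) ≥ 4n/3
-- good edges.

𝟙 : ∀ {p} {P : Set p} → Dec P → ℕ
𝟙 P? = if does P? then 1 else 0

𝟙-≤-+ : ∀ {p q r} {P : Set p} {Q : Set q} {R : Set r} → (P → ¬ R → Q) →
  (P? : Dec P) (Q? : Dec Q) (R? : Dec R) → 𝟙 P? ≤ 𝟙 Q? + 𝟙 R?
𝟙-≤-+ _   (no _)  _       _       = z≤n
𝟙-≤-+ _   (yes _) Q?      (yes _) = m≤n+m 1 (𝟙 Q?)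
𝟙-≤-+ _   (yes _) (yes _) (no _)  = s≤s z≤n
𝟙-≤-+ P⇒Q (yes p) (no ¬q) (no ¬r) = contradiction (P⇒Q p ¬r) ¬q

𝟙-*-≤ : ∀ {p q r s t} {P : Set p} {Q : Set q} {R : Set r} {S : Set s} {T : Set t} →
  (P → Q → ¬ R → ¬ S → T) →
  (P? : Dec P) (Q? : Dec Q) (R? : Dec R) (S? : Dec S) (T? : Dec T) →
  𝟙 P? * 𝟙 Q? ≤ 𝟙 T? + (𝟙 R? * 𝟙 P? + 𝟙 S? * 𝟙 Q?)
𝟙-*-≤ _    (no _)  _       _       _       _       = z≤n
𝟙-*-≤ _    (yes _) (no _)  _       _       _       = z≤n
𝟙-*-≤ _    (yes _) (yes _) (yes _) S?      T?      = ≤-trans (s≤s z≤n) (m≤n+m (suc (𝟙 S? * 1)) (𝟙 T?))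
𝟙-*-≤ _    (yes _) (yes _) (no _)  (yes _) T?      = m≤n+m 1 (𝟙 T?)
𝟙-*-≤ _    (yes _) (yes _) (no _)  (no _)  (yes _) = s≤s z≤n
𝟙-*-≤ PQ⇒T (yes p) (yes q) (no ¬r) (no ¬s) (no ¬t) = contradiction (PQ⇒T p q ¬r ¬s) ¬t

∑-mono-≤ : ∀ {n} {f g : Fin n → ℕ} → (∀ i → f i ≤ g i) → ∑[ i < n ] f i ≤ ∑[ i < n ] g i
∑-mono-≤ {zero}  f≤g = z≤n
∑-mono-≤ {suc n} f≤g = +-mono-≤ (f≤g zero) (∑-mono-≤ (f≤g ∘ suc))

∑-weighted-≤ : ∀ {n k} (f w : Fin n → ℕ) → (∀ i → f i ≤ k) →
  ∑[ i < n ] (f i * w i) ≤ k * ∑[ i < n ] w i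
∑-weighted-≤ {zero}      f w f≤k = z≤n
∑-weighted-≤ {suc n} {k} f w f≤k = begin
  f zero * w zero + ∑[ i < n ] (f (suc i) * w (suc i))
    ≤⟨ +-mono-≤ (*-monoˡ-≤ (w zero) (f≤k zero)) (∑-weighted-≤ (f ∘ suc) (w ∘ suc) (f≤k ∘ suc)) ⟩
  k * w zero + k * ∑[ i < n ] w (suc i)
    ≡⟨ *-distribˡ-+ k (w zero) _ ⟨
  k * (w zero + ∑[ i < n ] w (suc i))
    ∎
  where open ≤-Reasoning

∑∑-weighted-≤ : ∀ {m k n} d (h : Fin m → Fin k → ℕ) (w : Fin m → ℕ) →
  (∀ i → d * ∑[ j < k ] h i j + d ≤ n) →
  d * ∑[ i < m ] ∑[ j < k ] (h i j * w i) + d * ∑[ i < m ] w i ≤ n * ∑[ i < m ] w i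
∑∑-weighted-≤ {m} {k} {n} d h w row-≤ = begin
  d * ∑[ i < m ] ∑[ j < k ] (h i j * w i) + d * ∑[ i < m ] w i
    ≡⟨ cong₂ _+_ (*-distribˡ-sum d (λ i → ∑[ j < k ] (h i j * w i))) (*-distribˡ-sum d w) ⟩
  ∑[ i < m ] (d * ∑[ j < k ] (h i j * w i)) + ∑[ i < m ] (d * w i)
    ≡⟨ ∑-distrib-+ (λ i → d * ∑[ j < k ] (h i j * w i)) (λ i → d * w i) ⟨
  ∑[ i < m ] (d * ∑[ j < k ] (h i j * w i) + d * w i)
    ≡⟨ sum-cong-≗ row ⟩
  ∑[ i < m ] ((d * ∑[ j < k ] h i j + d) * w i)
    ≤⟨ ∑-weighted-≤ (λ i → d * ∑[ j < k ] h i j + d) w row-≤ ⟩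
  n * ∑[ i < m ] w i
    ∎
  where
  open ≤-Reasoning
  factor : ∀ d x y → d * (x * y) + d * y ≡ (d * x + d) * y
  factor = solve-∀
  row : ∀ i → d * ∑[ j < k ] (h i j * w i) + d * w i ≡ (d * ∑[ j < k ] h i j + d) * w i
  row i = trans (cong (λ z → d * z + d * w i) (sym (*-distribʳ-sum (w i) (h i))))
                (factor d (∑[ j < k ] h i j) (w i))

module _ {a p} {A : Set a} {P : Pred A p} (P? : Decidable P) where

  length-filter-split : ∀ xs → length xs ≡ length (filter P? xs) + length (filter (¬? ∘ P?) xs)
  length-filter-split []       = refl
  length-filter-split (x ∷ xs) with P? x
  ... | yes _ = cong suc (length-filter-split xs)
  ... | no  _ = trans (cong suc (length-filter-split xs)) (sym (+-suc _ _))

  length-filter-tabulate : ∀ {n} (f : Fin n → A) →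
    length (filter P? (tabulate f)) ≡ ∑[ i < n ] 𝟙 (P? (f i))
  length-filter-tabulate {zero}  f = refl
  length-filter-tabulate {suc n} f with P? (f zero)
  ... | yes _ = cong suc (length-filter-tabulate (f ∘ suc))
  ... | no  _ = length-filter-tabulate (f ∘ suc)

∑-𝟙-split : ∀ {a p} {A : Set a} {P : Pred A p} (P? : Decidable P) {n} (f : Fin n → A) →
  ∑[ i < n ] 𝟙 (P? (f i)) + ∑[ i < n ] 𝟙 (¬? (P? (f i))) ≡ n
∑-𝟙-split P? {n} f = begin
  ∑[ i < n ] 𝟙 (P? (f i)) + ∑[ i < n ] 𝟙 (¬? (P? (f i)))
    ≡⟨ cong₂ _+_ (length-filter-tabulate P? f) (length-filter-tabulate (¬? ∘ P?) f) ⟨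
  length (filter P? (tabulate f)) + length (filter (¬? ∘ P?) (tabulate f))
    ≡⟨ length-filter-split P? (tabulate f) ⟨
  length (tabulate f)
    ≡⟨ length-tabulate f ⟩
  n ∎
  where open ≡-Reasoning

length-filter-cartesianProduct :
  ∀ {b c p} {B : Set b} {C : Set c} {P : Pred (B × C) p} (P? : Decidable P) {m n}
  (f : Fin m → B) (g : Fin n → C) →
  length (filter P? (cartesianProduct (tabulate f) (tabulate g))) ≡ ∑[ i < m ] ∑[ j < n ] 𝟙 (P? (f i , g j))
length-filter-cartesianProduct P? {zero}      f g = refl
length-filter-cartesianProduct P? {suc m} {n} f g = begin
  length (filter P? (row ++ rest))                  ≡⟨ cong length (filter-++ P? row rest) ⟩
  length (filter P? row ++ filter P? rest)          ≡⟨ length-++ (filter P? row) ⟩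
  length (filter P? row) + length (filter P? rest)  ≡⟨ cong₂ _+_ row-count rest-count ⟩
  ∑[ j < n ] 𝟙 (P? (f zero , g j)) + ∑[ i < m ] ∑[ j < n ] 𝟙 (P? (f (suc i) , g j)) ∎
  where
  open ≡-Reasoning
  row  = map (f zero ,_) (tabulate g)
  rest = cartesianProduct (tabulate (f ∘ suc)) (tabulate g)
  row-count : length (filter P? row) ≡ ∑[ j < n ] 𝟙 (P? (f zero , g j))
  row-count = trans (cong (length ∘ filter P?) (map-tabulate g (f zero ,_)))
                    (length-filter-tabulate P? ((f zero ,_) ∘ g))
  rest-count = length-filter-cartesianProduct P? (f ∘ suc) g

unique-constant-length≤1 : ∀ {a} {A : Set a} {v : A} {xs} → Unique xs → All (_≡ v) xs → length xs ≤ 1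
unique-constant-length≤1 []              []              = z≤n
unique-constant-length≤1 (_ ∷ [])        _               = s≤s z≤n
unique-constant-length≤1 ((x≢y ∷ _) ∷ _) (x≡v ∷ y≡v ∷ _) = contradiction (trans x≡v (sym y≡v)) x≢y

module _ {a} {A : Set a} (_≟_ : DecidableEquality A) where

  length-filter-≡-≤1 : ∀ v {xs} → Unique xs → length (filter (_≟ v) xs) ≤ 1
  length-filter-≡-≤1 v {xs} xs! =
    unique-constant-length≤1 (unique-filter⁺ (_≟ v) xs!) (all-filter (_≟ v) xs)

  deduplicate-⊆ : ∀ xs → deduplicate _≟_ xs ⊆ xs
  deduplicate-⊆ []       = []
  deduplicate-⊆ (x ∷ xs) =
    refl ∷ ⊆-trans (filter-⊆ (¬? ∘ (x ≟_)) (deduplicate _≟_ xs)) (deduplicate-⊆ xs)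

  length-deduplicate-≤ : ∀ v xs → length (deduplicate _≟_ xs) ≤ suc (length (filter (¬? ∘ (_≟ v)) xs))
  length-deduplicate-≤ v xs = begin
    length ys                                                       ≡⟨ length-filter-split (_≟ v) ys ⟩
    length (filter (_≟ v) ys) + length (filter (¬? ∘ (_≟ v)) ys)  ≤⟨ +-mono-≤ at-most-one-v fewer-others ⟩
    suc (length (filter (¬? ∘ (_≟ v)) xs))                          ∎
    where
    open ≤-Reasoning
    ys = deduplicate _≟_ xs
    at-most-one-v : length (filter (_≟ v) ys) ≤ 1
    at-most-one-v = length-filter-≡-≤1 v (DecUnique.deduplicate-! _≟_ xs)
    fewer-others : length (filter (¬? ∘ (_≟ v)) ys) ≤ length (filter (¬? ∘ (_≟ v)) xs)
    fewer-others =
      length-mono-≤ (sublist-filter⁺ (¬? ∘ (_≟ v)) (¬? ∘ (_≟ v)) (λ { refl p → p }) (deduplicate-⊆ xs))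

∑-𝟙-≟-≤1 : ∀ {n} (k : Fin n) → ∑[ i < n ] 𝟙 (i F≟ k) ≤ 1
∑-𝟙-≟-≤1 {n} k =
  subst (_≤ 1) (length-filter-tabulate (_F≟ k) id) (length-filter-≡-≤1 _F≟_ k (allFin⁺ n))

colourDegree : ∀ {n} → (Fin n → ℕ) → ℕ
colourDegree {n} f = length (deduplicate _≟_ (map f (allFin n)))

module _ {n} (f : Fin n → ℕ) (v : ℕ) where

  colourDegree-≤ : colourDegree f ≤ suc (∑[ i < n ] 𝟙 (¬? (f i ≟ v)))
  colourDegree-≤ =
    subst (λ m → colourDegree f ≤ suc m) others-count (length-deduplicate-≤ _≟_ v (map f (allFin n)))
    where
    others-count : length (filter (¬? ∘ (_≟ v)) (map f (allFin n))) ≡ ∑[ i < n ] 𝟙 (¬? (f i ≟ v))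
    others-count = trans (cong (length ∘ filter (¬? ∘ (_≟ v))) (map-tabulate id f))
                         (length-filter-tabulate (¬? ∘ (_≟ v)) f)

  module _ (2n+6≤3d : 2 * n + 6 ≤ 3 * colourDegree f) where

    others-≥ : 2 * n + 3 ≤ 3 * ∑[ i < n ] 𝟙 (¬? (f i ≟ v))
    others-≥ = +-cancelʳ-≤ 3 _ _ (begin
      2 * n + 3 + 3       ≡⟨ +-assoc (2 * n) 3 3 ⟩
      2 * n + 6           ≤⟨ 2n+6≤3d ⟩
      3 * colourDegree f  ≤⟨ *-monoʳ-≤ 3 colourDegree-≤ ⟩
      3 * suc m           ≡⟨ *-suc 3 m ⟩
      3 + 3 * m           ≡⟨ +-comm 3 (3 * m) ⟩
      3 * m + 3           ∎)
      where
      open ≤-Reasoning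
      m = ∑[ i < n ] 𝟙 (¬? (f i ≟ v))

    colourClass-≤ : 3 * ∑[ i < n ] 𝟙 (f i ≟ v) + 3 ≤ n
    colourClass-≤ = begin
      3 * e + 3        ≡⟨ split e ⟩
      e + (2 * e + 3)  ≤⟨ +-monoʳ-≤ e 2e+3≤m ⟩
      e + m            ≡⟨ e+m≡n ⟩
      n                ∎
      where
      open ≤-Reasoning
      e m : ℕ
      e = ∑[ i < n ] 𝟙 (f i ≟ v)
      m = ∑[ i < n ] 𝟙 (¬? (f i ≟ v))
      e+m≡n : e + m ≡ n
      e+m≡n = ∑-𝟙-split (_≟ v) f
      split : ∀ e → 3 * e + 3 ≡ e + (2 * e + 3)
      split = solve-∀
      regroup : ∀ e m → 2 * e + 3 + 2 * m ≡ 2 * (e + m) + 3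
      regroup = solve-∀
      2e+3≤m : 2 * e + 3 ≤ m
      2e+3≤m = +-cancelʳ-≤ (2 * m) _ _ (begin
        2 * e + 3 + 2 * m  ≡⟨ regroup e m ⟩
        2 * (e + m) + 3    ≡⟨ cong (λ k → 2 * k + 3) e+m≡n ⟩
        2 * n + 3          ≤⟨ others-≥ ⟩
        3 * m              ≡⟨⟩
        m + 2 * m          ∎)

    covers-others⇒large : ∀ {s} {S : Pred (Fin n) s} (S? : Decidable S) (k : Fin n) →
      (∀ i → ¬ f i ≡ v → ¬ i ≡ k → S i) → 2 * n ≤ 3 * ∑[ i < n ] 𝟙 (S? i)
    covers-others⇒large S? k covers = +-cancelʳ-≤ 3 _ _ (begin
      2 * n + 3                        ≤⟨ others-≥ ⟩
      3 * ∑[ i < n ] 𝟙 (¬? (f i ≟ v))  ≤⟨ *-monoʳ-≤ 3 others-≤ ⟩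
      3 * (size + 1)                   ≡⟨ *-distribˡ-+ 3 size 1 ⟩
      3 * size + 3                     ∎)
      where
      open ≤-Reasoning
      size = ∑[ i < n ] 𝟙 (S? i)
      others-≤ : ∑[ i < n ] 𝟙 (¬? (f i ≟ v)) ≤ size + 1
      others-≤ = begin
        ∑[ i < n ] 𝟙 (¬? (f i ≟ v))
          ≤⟨ ∑-mono-≤ (λ i → 𝟙-≤-+ (covers i) (¬? (f i ≟ v)) (S? i) (i F≟ k)) ⟩
        ∑[ i < n ] (𝟙 (S? i) + 𝟙 (i F≟ k))
          ≡⟨ ∑-distrib-+ (𝟙 ∘ S?) (λ i → 𝟙 (i F≟ k)) ⟩
        size + ∑[ i < n ] 𝟙 (i F≟ k)
          ≤⟨ +-monoʳ-≤ size (∑-𝟙-≟-≤1 k) ⟩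
        size + 1
          ∎

-- With 3a = 2n + s and 3b = 2n + t, three times the left-hand side of the hypothesis equals
-- 3 · 4n + n(3a + 3b) + excess with excess ≥ 0.
quadratic-bound : ∀ n T a b → 2 * n ≤ 3 * a → 2 * n ≤ 3 * b →
  3 * (a * b) + 3 * a + 3 * b ≤ 3 * T + n * a + n * b → 4 * n ≤ 3 * T
quadratic-bound n T a b 2n≤3a 2n≤3b h
  with s , 2n+s≡3a ← m≤n⇒∃[o]m+o≡n 2n≤3a | t , 2n+t≡3b ← m≤n⇒∃[o]m+o≡n 2n≤3b =
  *-cancelˡ-≤ 3 (+-cancelʳ-≤ (n * p + n * q) _ _ (begin
    3 * (4 * n) + (n * p + n * q)                                  ≤⟨ m≤m+n _ excess ⟩
    3 * (4 * n) + (n * p + n * q) + excess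
      ≡⟨ cong₂ (λ p q → 3 * (4 * n) + (n * p + n * q) + excess) 2n+s≡3a 2n+t≡3b ⟨
    3 * (4 * n) + (n * (2 * n + s) + n * (2 * n + t)) + excess     ≡⟨ expand n s t ⟩
    (2 * n + s) * (2 * n + t) + 3 * (2 * n + s) + 3 * (2 * n + t)
      ≡⟨ cong₂ (λ p q → p * q + 3 * p + 3 * q) 2n+s≡3a 2n+t≡3b ⟩
    p * q + 3 * p + 3 * q                                          ≡⟨ scale a b ⟩
    3 * (3 * (a * b) + 3 * a + 3 * b)                              ≤⟨ *-monoʳ-≤ 3 h ⟩
    3 * (3 * T + n * a + n * b)                                    ≡⟨ distribute n T a b ⟩
    3 * (3 * T) + (n * p + n * q)                                  ∎))
  where
  open ≤-Reasoning
  p = 3 * a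
  q = 3 * b
  excess = n * (s + t) + s * t + 3 * (s + t)
  expand : ∀ n s t →
    3 * (4 * n) + (n * (2 * n + s) + n * (2 * n + t)) + (n * (s + t) + s * t + 3 * (s + t))
      ≡ (2 * n + s) * (2 * n + t) + 3 * (2 * n + s) + 3 * (2 * n + t)
  expand = solve-∀
  scale : ∀ a b → 3 * a * (3 * b) + 3 * (3 * a) + 3 * (3 * b) ≡ 3 * (3 * (a * b) + 3 * a + 3 * b)
  scale = solve-∀
  distribute : ∀ n T a b → 3 * (3 * T + n * a + n * b) ≡ 3 * (3 * T) + (n * (3 * a) + n * (3 * b))
  distribute = solve-∀

module Configuration {n} (c : Colouring n) (x₁ x₂ y₁ y₂ : Fin n) where

  InA : Fin n → Set
  InA x = ¬ x ≡ x₁ × ¬ x ≡ x₂ × ¬ c x y₁ ≡ c x₁ y₁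

  InB : Fin n → Set
  InB y = ¬ y ≡ y₁ × ¬ y ≡ y₂ × ¬ c x₂ y ≡ c x₂ y₂

  inA? : Decidable InA
  inA? x = ¬? (x F≟ x₁) ×-dec ¬? (x F≟ x₂) ×-dec ¬? (c x y₁ ≟ c x₁ y₁)

  inB? : Decidable InB
  inB? y = ¬? (y F≟ y₁) ×-dec ¬? (y F≟ y₂) ×-dec ¬? (c x₂ y ≟ c x₂ y₂)

  good-unless-clash : ∀ {x y} → InA x → InB y → ¬ c x y ≡ c x y₁ → ¬ c x y ≡ c x₂ y →
    Good c x₁ x₂ y₁ y₂ (x , y)
  good-unless-clash (x≢x₁ , x≢x₂ , xy₁≢x₁y₁) (y≢y₁ , y≢y₂ , x₂y≢x₂y₂) xy≢xy₁ xy≢x₂y =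
    (x≢x₁ , x≢x₂ , y≢y₁ , y≢y₂) , (xy₁≢x₁y₁ ∘ sym , xy≢xy₁ ∘ sym , xy≢x₂y , x₂y≢x₂y₂)

  a b T X Y : ℕ
  a = ∑[ x < n ] 𝟙 (inA? x)
  b = ∑[ y < n ] 𝟙 (inB? y)
  T = ∑[ x < n ] ∑[ y < n ] 𝟙 (good? c x₁ x₂ y₁ y₂ (x , y))
  X = ∑[ x < n ] ∑[ y < n ] (𝟙 (c x y ≟ c x y₁) * 𝟙 (inA? x))
  Y = ∑[ x < n ] ∑[ y < n ] (𝟙 (c x y ≟ c x₂ y) * 𝟙 (inB? y))

  countGood≡T : countGood c x₁ x₂ y₁ y₂ ≡ T
  countGood≡T = length-filter-cartesianProduct (good? c x₁ x₂ y₁ y₂) id id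

  a*b≤T+[X+Y] : a * b ≤ T + (X + Y)
  a*b≤T+[X+Y] = begin
    a * b                                            ≡⟨ *-distribʳ-sum b (𝟙 ∘ inA?) ⟩
    ∑[ x < n ] (𝟙 (inA? x) * b)
      ≡⟨ sum-cong-≗ (λ x → *-distribˡ-sum (𝟙 (inA? x)) (𝟙 ∘ inB?)) ⟩
    ∑[ x < n ] ∑[ y < n ] (𝟙 (inA? x) * 𝟙 (inB? y))  ≤⟨ ∑-mono-≤ (λ x → ∑-mono-≤ (pair-≤ x)) ⟩
    ∑[ x < n ] ∑[ y < n ] (G x y + (E x y + F x y))  ≡⟨ sum-cong-≗ (λ x → split (G x) (E x) (F x)) ⟩
    ∑[ x < n ] (∑[ y < n ] G x y + (∑[ y < n ] E x y + ∑[ y < n ] F x y))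
      ≡⟨ split (λ x → ∑[ y < n ] G x y) (λ x → ∑[ y < n ] E x y) (λ x → ∑[ y < n ] F x y) ⟩
    T + (X + Y)                                      ∎
    where
    open ≤-Reasoning
    G E F : Fin n → Fin n → ℕ
    G x y = 𝟙 (good? c x₁ x₂ y₁ y₂ (x , y))
    E x y = 𝟙 (c x y ≟ c x y₁) * 𝟙 (inA? x)
    F x y = 𝟙 (c x y ≟ c x₂ y) * 𝟙 (inB? y)
    pair-≤ : ∀ x y → 𝟙 (inA? x) * 𝟙 (inB? y) ≤ G x y + (E x y + F x y)
    pair-≤ x y = 𝟙-*-≤ good-unless-clash (inA? x) (inB? y) (c x y ≟ c x y₁) (c x y ≟ c x₂ y)
                       (good? c x₁ x₂ y₁ y₂ (x , y))
    split : (f g h : Fin n → ℕ) →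
      ∑[ i < n ] (f i + (g i + h i)) ≡ ∑[ i < n ] f i + (∑[ i < n ] g i + ∑[ i < n ] h i)
    split f g h = trans (∑-distrib-+ f (λ i → g i + h i)) (cong (∑[ i < n ] f i +_) (∑-distrib-+ g h))

  module HighColourDegree (δX : ∀ x → 2 * n + 6 ≤ 3 * colDegX c x)
                          (δY : ∀ y → 2 * n + 6 ≤ 3 * colDegY c y) where

    2n≤3a : 2 * n ≤ 3 * a
    2n≤3a = covers-others⇒large (λ x → c x y₁) (c x₁ y₁) (δY y₁) inA? x₂
      (λ x xy₁≢x₁y₁ x≢x₂ → (λ { refl → xy₁≢x₁y₁ refl }) , x≢x₂ , xy₁≢x₁y₁)

    2n≤3b : 2 * n ≤ 3 * b
    2n≤3b = covers-others⇒large (c x₂) (c x₂ y₂) (δX x₂) inB? y₁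
      (λ y x₂y≢x₂y₂ y≢y₁ → y≢y₁ , (λ { refl → x₂y≢x₂y₂ refl }) , x₂y≢x₂y₂)

    3X+3a≤na : 3 * X + 3 * a ≤ n * a
    3X+3a≤na = ∑∑-weighted-≤ 3 (λ x y → 𝟙 (c x y ≟ c x y₁)) (𝟙 ∘ inA?)
      (λ x → colourClass-≤ (c x) (c x y₁) (δX x))

    3Y+3b≤nb : 3 * Y + 3 * b ≤ n * b
    3Y+3b≤nb = subst (λ z → 3 * z + 3 * b ≤ n * b)
      (∑-comm (λ y x → 𝟙 (c x y ≟ c x₂ y) * 𝟙 (inB? y)))
      (∑∑-weighted-≤ 3 (λ y x → 𝟙 (c x y ≟ c x₂ y)) (𝟙 ∘ inB?)
        (λ y → colourClass-≤ (λ x → c x y) (c x₂ y) (δY y)))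

    3ab+3a+3b≤3T+na+nb : 3 * (a * b) + 3 * a + 3 * b ≤ 3 * T + n * a + n * b
    3ab+3a+3b≤3T+na+nb = begin
      3 * (a * b) + 3 * a + 3 * b
        ≤⟨ +-monoˡ-≤ (3 * b) (+-monoˡ-≤ (3 * a) (*-monoʳ-≤ 3 a*b≤T+[X+Y])) ⟩
      3 * (T + (X + Y)) + 3 * a + 3 * b
        ≡⟨ regroup T X Y a b ⟩
      3 * T + (3 * X + 3 * a) + (3 * Y + 3 * b)
        ≤⟨ +-mono-≤ (+-monoʳ-≤ (3 * T) 3X+3a≤na) 3Y+3b≤nb ⟩
      3 * T + n * a + n * b
        ∎
      where
      open ≤-Reasoning
      regroup : ∀ T X Y a b → 3 * (T + (X + Y)) + 3 * a + 3 * b ≡ 3 * T + (3 * X + 3 * a) + (3 * Y + 3 * b)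
      regroup = solve-∀

-- The argument never uses x₁ ≢ x₂ or y₁ ≢ y₂.
lemma3p8 : (n : ℕ) (c : Colouring n) →
    (∀ (v : Fin n) → 2 * n + 6 ≤ 3 * colDegX c v) →
    (∀ (v : Fin n) → 2 * n + 6 ≤ 3 * colDegY c v) →
    (x₁ x₂ y₁ y₂ : Fin n) → ¬ x₁ ≡ x₂ → ¬ y₁ ≡ y₂ →
    4 * n ≤ 3 * countGood c x₁ x₂ y₁ y₂
lemma3p8 n c δX δY x₁ x₂ y₁ y₂ _ _ =
  subst (λ m → 4 * n ≤ 3 * m) (sym countGood≡T)
    (quadratic-bound n T a b 2n≤3a 2n≤3b 3ab+3a+3b≤3T+na+nb)
  where
  open Configuration c x₁ x₂ y₁ y₂
  open HighColourDegree δX δY
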